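{- Let $t \ge 1$ be an integer and $T$ a $t$-arc-bounded tournament. Suppose $P = (v_0, v_1, \ldots, v_k)$ is a shortest directed path in $T$ from $v_0$ to $v_k$, and let $S = (N^-(v_0) \cap N^+(v_k)) \cup V(P)$. Then $\vec\chi(T[S]) \le 5t$.
   Context: For a vertex $v$, $N^+(v)$, $N^-(v)$ are the out- and in-neighbourhoods; for an arc $e = uv$, $N(e) = N^+(v)\cap N^-(u)$. $\vec\chi$ of a tournament is the minimum number of acyclic induced subtournaments partitioning its vertex set. $T$ is $t$-arc-bounded if $\vec\chi(T[N(e)]) \le t$ for every arc $e$. -}

module Defs where

open import Data.Nat using (ℕ; suc)
open import Data.Fin using (Fin; inject₁; fromℕ)
open import Data.Fin.Base using () renaming (suc to fsuc)
open import Data.Product using (Σ; _×_; _,_)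
open import Data.Sum using (_⊎_)
open import Relation.Binary.PropositionalEquality using (_≡_; _≢_)
open import Relation.Nullary using (¬_)
open import Function.Definitions using (Injective)
open import Level using (0ℓ)

record Tournament (n : ℕ) : Set₁ where
  field
    _⇒_     : Fin n → Fin n → Set
    irrefl  : ∀ v → ¬ (v ⇒ v)
    asym    : ∀ u v → u ⇒ v → ¬ (v ⇒ u)
    total   : ∀ u v → u ≢ v → (u ⇒ v) ⊎ (v ⇒ u)

VSet : ℕ → Set₁
VSet n = Fin n → Set

module _ {n : ℕ} (T : Tournament n) where
  open Tournament T

  N⁺ : Fin n → VSet n
  N⁺ v w = v ⇒ w

  N⁻ : Fin n → VSet n
  N⁻ v w = w ⇒ v

  Narc : Fin n → Fin n → VSet n
  Narc u v w = N⁺ v w × N⁻ u w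

  -- A directed cycle inside X: distinct vertices c₀,…,c_m (m ≥ 0, so
  -- at least one vertex) all in X, with arcs c_i ⇒ c_{i+1} and c_m ⇒ c₀.
  -- (Since ⇒ is irreflexive, cycles have length ≥ 3 in a tournament.)
  DirCycleIn : VSet n → Set
  DirCycleIn X =
    Σ ℕ λ m → Σ (Fin (suc m) → Fin n) λ c →
      Injective _≡_ _≡_ c
      × (∀ i → X (c i))
      × (∀ (i : Fin m) → c (inject₁ i) ⇒ c (fsuc i))
      × (c (fromℕ m) ⇒ c Data.Fin.zero)

  Acyclic : VSet n → Set
  Acyclic X = ¬ DirCycleIn X

  -- χ⃗(T[X]) ≤ c : X can be partitioned into c sets each inducing an
  -- acyclic subtournament (given by a colouring with c colours).
  DichromaticLE : VSet n → ℕ → Set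
  DichromaticLE X c =
    Σ (Fin n → Fin c) λ col →
      ∀ (i : Fin c) → Acyclic (λ v → X v × col v ≡ i)

  ArcBounded : ℕ → Set
  ArcBounded t = ∀ u v → u ⇒ v → DichromaticLE (Narc u v) t

  IsDirPath : (k : ℕ) → (Fin (suc k) → Fin n) → Set
  IsDirPath k p =
    Injective _≡_ _≡_ p × (∀ (i : Fin k) → p (inject₁ i) ⇒ p (fsuc i))

  IsShortestDirPath : (k : ℕ) → (Fin (suc k) → Fin n) → Set
  IsShortestDirPath k p =
    IsDirPath k p ×
    (∀ (j : ℕ) (q : Fin (suc j) → Fin n) → IsDirPath j q →
       q Data.Fin.zero ≡ p Data.Fin.zero → q (fromℕ j) ≡ p (fromℕ k) →
       k Data.Nat.≤ j)

  PathVerts : (k : ℕ) → (Fin (suc k) → Fin n) → VSet n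
  PathVerts k p w = Σ (Fin (suc k)) λ i → p i ≡ w

{-# OPTIONS --safe #-}
-- Give each vertex p_i of P the level i, and each other vertex w of S the position ℓ
-- of its last out-neighbour on P; then w ∈ N(p_ℓ p_{ℓ+1}) because p_k ⇒ w. Since P is
-- shortest, an arc u ⇒ v of T[S] together with at most two arcs to and from P cannot
-- shortcut P, so level v ≤ level u + 4. Colouring by (level mod 5, a t-colouring of the
-- arc neighbourhood of the level) therefore makes every monochromatic cycle stay in
-- one level, where p_ℓ is a sink and the other vertices induce acyclic colour classes.
module Submission where

open import Defs
open import Data.Nat using (ℕ; suc; _≤_; _*_)
open import Data.Fin using (Fin; zero; fromℕ)
open import Data.Product using (_×_)
open import Data.Sum using (_⊎_)

open import Data.Nat using (zero; _+_; _∸_; _<_; z≤n; s≤s; z<s; _%_; _/_; _<?_; NonZero)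
open import Data.Nat.Properties
open import Data.Nat.DivMod using (_mod_; m≡m%n+[m/n]*n; m%n<n; /-monoˡ-≤)
open import Data.Fin using (inject₁; toℕ; fromℕ<; combine) renaming (suc to fsuc)
open import Data.Fin.Properties
  using (any?; toℕ≤pred[n]; toℕ-fromℕ<; combine-injective)
  renaming (_≟_ to _≟ᶠ_; suc-injective to fsuc-injective)
open import Data.Vec.Functional using (_∷_)
open import Data.Product using (∃; _,_; proj₁; proj₂)
open import Data.Sum using (inj₁; inj₂; [_,_]′)
open import Data.Empty using (⊥; ⊥-elim)
open import Function using (_∘_)
open import Relation.Nullary using (¬_; Dec; yes; no)
open import Relation.Unary using (Decidable)
open import Relation.Binary.PropositionalEquality
open import Function.Definitions using (Injective)

m%n≡o%n⇒m<o⇒m+n≤o : ∀ {m o} n .{{_ : NonZero n}} → m % n ≡ o % n → m < o → m + n ≤ o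
m%n≡o%n⇒m<o⇒m+n≤o {m} {o} n m%n≡o%n m<o = begin
  m + n                    ≡⟨ cong (_+ n) (m≡m%n+[m/n]*n m n) ⟩
  m % n + m / n * n + n    ≡⟨ +-assoc (m % n) (m / n * n) n ⟩
  m % n + (m / n * n + n)  ≡⟨ cong (m % n +_) (+-comm (m / n * n) n) ⟩
  m % n + suc (m / n) * n  ≤⟨ +-monoʳ-≤ (m % n) (*-monoˡ-≤ n m/n<o/n) ⟩
  m % n + o / n * n        ≡⟨ cong (_+ o / n * n) m%n≡o%n ⟩
  o % n + o / n * n        ≡⟨ m≡m%n+[m/n]*n o n ⟨
  o                        ∎
  where
  open ≤-Reasoning
  m/n<o/n : m / n < o / n
  m/n<o/n = ≤∧≢⇒< (/-monoˡ-≤ n (<⇒≤ m<o)) λ m/n≡o/n → <⇒≢ m<o (begin-equality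
    m                  ≡⟨ m≡m%n+[m/n]*n m n ⟩
    m % n + m / n * n  ≡⟨ cong₂ (λ r q → r + q * n) m%n≡o%n m/n≡o/n ⟩
    o % n + o / n * n  ≡⟨ m≡m%n+[m/n]*n o n ⟨
    o                  ∎)

mod≡⇒%≡ : ∀ {m o} n .{{_ : NonZero n}} → m mod n ≡ o mod n → m % n ≡ o % n
mod≡⇒%≡ {m} {o} n eq = begin
  m % n            ≡⟨ toℕ-fromℕ< (m%n<n m n) ⟨
  toℕ (m mod n)    ≡⟨ cong toℕ eq ⟩
  toℕ (o mod n)    ≡⟨ toℕ-fromℕ< (m%n<n o n) ⟩
  o % n            ∎
  where open ≡-Reasoning

inject₁-or-fromℕ : ∀ {m} (i : Fin (suc m)) → (∃ λ j → i ≡ inject₁ j) ⊎ i ≡ fromℕ m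
inject₁-or-fromℕ {zero}  zero     = inj₂ refl
inject₁-or-fromℕ {suc m} zero     = inj₁ (zero , refl)
inject₁-or-fromℕ {suc m} (fsuc i) with inject₁-or-fromℕ i
... | inj₁ (j , i≡j) = inj₁ (fsuc j , cong fsuc i≡j)
... | inj₂ i≡last    = inj₂ (cong fsuc i≡last)

antitone-bounds : ∀ m (f : Fin (suc m) → ℕ) → (∀ i → f (fsuc i) ≤ f (inject₁ i)) →
                  ∀ j → f (fromℕ m) ≤ f j × f j ≤ f zero
antitone-bounds zero    f f↓ zero     = ≤-refl , ≤-refl
antitone-bounds (suc m) f f↓ zero     =
  ≤-trans (proj₁ (antitone-bounds m (f ∘ fsuc) (f↓ ∘ fsuc) zero)) (f↓ zero) , ≤-refl
antitone-bounds (suc m) f f↓ (fsuc j) =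
  let last≤fⱼ , fⱼ≤f₁ = antitone-bounds m (f ∘ fsuc) (f↓ ∘ fsuc) j
  in last≤fⱼ , ≤-trans fⱼ≤f₁ (f↓ zero)

cyclically-antitone⇒constant : ∀ m (f : Fin (suc m) → ℕ) → (∀ i → f (fsuc i) ≤ f (inject₁ i)) →
                               f zero ≤ f (fromℕ m) → ∀ j → f j ≡ f zero
cyclically-antitone⇒constant m f f↓ f₀≤last j =
  let last≤fⱼ , fⱼ≤f₀ = antitone-bounds m f f↓ j
  in ≤-antisym fⱼ≤f₀ (≤-trans f₀≤last last≤fⱼ)

-- The largest y ≤ x satisfying P, and 0 if there is none.
module _ {P : ℕ → Set} (P? : Decidable P) where

  lastBelow : ℕ → ℕ
  lastBelow zero = zero
  lastBelow (suc x) with P? (suc x)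
  ... | yes _ = suc x
  ... | no _  = lastBelow x

  lastBelow-holds : P 0 → ∀ x → P (lastBelow x)
  lastBelow-holds P₀ zero = P₀
  lastBelow-holds P₀ (suc x) with P? (suc x)
  ... | yes Px = Px
  ... | no _   = lastBelow-holds P₀ x

  lastBelow-≤ : ∀ x → lastBelow x ≤ x
  lastBelow-≤ zero = z≤n
  lastBelow-≤ (suc x) with P? (suc x)
  ... | yes _ = ≤-refl
  ... | no _  = m≤n⇒m≤1+n (lastBelow-≤ x)

  lastBelow-maximal : ∀ x {y} → lastBelow x < y → y ≤ x → ¬ P y
  lastBelow-maximal zero    last<y y≤x _ = <⇒≱ last<y y≤x
  lastBelow-maximal (suc x) {y} last<y y≤x Py with P? (suc x)
  ... | yes _ = <⇒≱ last<y y≤x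
  ... | no ¬Px with y ≟ suc x
  ...   | yes refl = ¬Px Py
  ...   | no y≢x   = lastBelow-maximal x last<y (≤-pred (≤∧≢⇒< y≤x y≢x)) Py

clamp : (k : ℕ) → ℕ → Fin (suc k)
clamp k       zero    = zero
clamp zero    (suc x) = zero
clamp (suc k) (suc x) = fsuc (clamp k x)

clamp-suc : ∀ {k x} → x < k → ∃ λ i → clamp k x ≡ inject₁ i × clamp k (suc x) ≡ fsuc i
clamp-suc {suc k} {zero}  _         = zero , refl , refl
clamp-suc {suc k} {suc x} (s≤s x<k) =
  let i , eq , eq′ = clamp-suc x<k in fsuc i , cong fsuc eq , cong fsuc eq′

clamp-toℕ : ∀ k (i : Fin (suc k)) → clamp k (toℕ i) ≡ i
clamp-toℕ k       zero     = refl
clamp-toℕ (suc k) (fsuc i) = cong fsuc (clamp-toℕ k i)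

clamp-self : ∀ k → clamp k k ≡ fromℕ k
clamp-self zero    = refl
clamp-self (suc k) = cong fsuc (clamp-self k)

module Tournaments {n : ℕ} (T : Tournament n) where
  open Tournament T

  _⇒?_ : ∀ u v → Dec (u ⇒ v)
  u ⇒? v with u ≟ᶠ v
  ... | yes refl = no (irrefl u)
  ... | no u≢v with total u v u≢v
  ...   | inj₁ u⇒v = yes u⇒v
  ...   | inj₂ v⇒u = no (asym v u v⇒u)

  cycle-successor : ∀ {m} {c : Fin (suc m) → Fin n} →
    (∀ i → c (inject₁ i) ⇒ c (fsuc i)) → c (fromℕ m) ⇒ c zero → ∀ i → ∃ λ j → c i ⇒ c j
  cycle-successor arcs wrap i with inject₁-or-fromℕ i
  ... | inj₁ (j , refl) = fsuc j , arcs j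
  ... | inj₂ refl       = zero , wrap

  acyclic-addSink : ∀ {X Y : VSet n} {v} → Acyclic T X →
    (∀ {w} → Y w → X w ⊎ w ≡ v) → (∀ {w} → Y w → ¬ (v ⇒ w)) → Acyclic T Y
  acyclic-addSink {X} {v = v} X-acyclic Y⊆X∪v v-sink (m , c , c-inj , c∈Y , arcs , wrap)
    with any? (λ i → c i ≟ᶠ v)
  ... | yes (i , refl) = let j , v⇒cⱼ = cycle-successor arcs wrap i in v-sink (c∈Y j) v⇒cⱼ
  ... | no v∉c = X-acyclic (m , c , c-inj , c∈X , arcs , wrap)
    where
    c∈X : ∀ i → X (c i)
    c∈X i = [ (λ x → x) , (λ cᵢ≡v → ⊥-elim (v∉c (i , cᵢ≡v))) ]′ (Y⊆X∪v (c∈Y i))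

  dichromatic-addSink : ∀ {X Y : VSet n} {v s} → DichromaticLE T X s →
    (∀ {w} → Y w → X w ⊎ w ≡ v) → (∀ {w} → Y w → ¬ (v ⇒ w)) → DichromaticLE T Y s
  dichromatic-addSink {X} {Y} (col , classes-acyclic) Y⊆X∪v v-sink =
    col , λ i → acyclic-addSink {λ w → X w × col w ≡ i} {λ w → Y w × col w ≡ i} (classes-acyclic i)
      (λ (y , colᵢ) → [ (λ x → inj₁ (x , colᵢ)) , inj₂ ]′ (Y⊆X∪v y))
      (λ (y , _) → v-sink y)

  dichromatic-∅ : ∀ {s} → Fin s → DichromaticLE T (λ _ → ⊥) s
  dichromatic-∅ i = (λ _ → i) , λ _ (_ , _ , _ , c∈∅ , _) → proj₁ (c∈∅ zero)

  -- Two vertices of one colour class have levels differing by a multiple of q, so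
  -- arcs inside a class never rise, and a cycle in the class stays in one level.
  dichromatic-layers : ∀ {X : VSet n} {s} q .{{_ : NonZero q}} (L : Fin n → ℕ) →
    (∀ {u v} → X u → X v → u ⇒ v → L v < L u + q) →
    (∀ ℓ → DichromaticLE T (λ w → X w × L w ≡ ℓ) s) →
    DichromaticLE T X (q * s)
  dichromatic-layers {X} {s} q L short-rise layers = colour , class-acyclic
    where
    layerColour : ℕ → Fin n → Fin s
    layerColour ℓ = proj₁ (layers ℓ)

    colour : Fin n → Fin (q * s)
    colour w = combine (L w mod q) (layerColour (L w) w)

    class-acyclic : ∀ c → Acyclic T (λ w → X w × colour w ≡ c)
    class-acyclic c (m , v , v-inj , v∈ , arcs , wrap) =
      proj₂ (layers ℓ) (layerColour ℓ (v zero)) (m , v , v-inj , v∈layer , arcs , wrap)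
      where
      same-colour : ∀ i j → L (v i) mod q ≡ L (v j) mod q
                          × layerColour (L (v i)) (v i) ≡ layerColour (L (v j)) (v j)
      same-colour i j = combine-injective _ _ _ _ (trans (proj₂ (v∈ i)) (sym (proj₂ (v∈ j))))

      non-rising : ∀ {i j} → v i ⇒ v j → L (v j) ≤ L (v i)
      non-rising {i} {j} vᵢ⇒vⱼ = ≮⇒≥ λ Lᵢ<Lⱼ →
        <⇒≱ (short-rise (proj₁ (v∈ i)) (proj₁ (v∈ j)) vᵢ⇒vⱼ)
            (m%n≡o%n⇒m<o⇒m+n≤o q (mod≡⇒%≡ q (proj₁ (same-colour i j))) Lᵢ<Lⱼ)

      ℓ : ℕ
      ℓ = L (v zero)

      level-constant : ∀ i → L (v i) ≡ ℓ
      level-constant = cyclically-antitone⇒constant m (L ∘ v) (non-rising ∘ arcs) (non-rising wrap)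

      v∈layer : ∀ i → (X (v i) × L (v i) ≡ ℓ) × layerColour ℓ (v i) ≡ layerColour ℓ (v zero)
      v∈layer i = (proj₁ (v∈ i) , level-constant i)
                , trans (cong (λ ℓ′ → layerColour ℓ′ (v i)) (sym (level-constant i)))
                        (proj₂ (same-colour i zero))

  data Walk : ℕ → Fin n → Fin n → Set where
    ε   : ∀ {a} → Walk 0 a a
    _◅_ : ∀ {j a b c} → a ⇒ b → Walk j b c → Walk (suc j) a c

  infixr 5 _◅_ _◅◅_

  _◅◅_ : ∀ {i j a b c} → Walk i a b → Walk j b c → Walk (i + j) a c
  ε ◅◅ w′ = w′
  (a⇒b ◅ w) ◅◅ w′ = a⇒b ◅ (w ◅◅ w′)

  PathWithin : ℕ → Fin n → Fin n → Set
  PathWithin j a c = ∃ λ l → ∃ λ (q : Fin (suc l) → Fin n) →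
    IsDirPath T l q × q zero ≡ a × q (fromℕ l) ≡ c × l ≤ j

  path-suffix : ∀ l {q : Fin (suc l) → Fin n} → IsDirPath T l q →
    ∀ i → PathWithin l (q i) (q (fromℕ l))
  path-suffix l       {q} q-path zero = l , q , q-path , refl , refl , ≤-refl
  path-suffix (suc l) (q-inj , q-arcs) (fsuc i) =
    let l′ , q′ , q′-path , start , end , l′≤l =
          path-suffix l (fsuc-injective ∘ q-inj , q-arcs ∘ fsuc) i
    in l′ , q′ , q′-path , start , end , m≤n⇒m≤1+n l′≤l

  path-cons : ∀ {l a} {q : Fin (suc l) → Fin n} → a ⇒ q zero → (∀ i → q i ≢ a) →
    IsDirPath T l q → IsDirPath T (suc l) (a ∷ q)
  path-cons {a = a} {q} a⇒q₀ a∉q (q-inj , q-arcs) = cons-inj , cons-arcs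
    where
    cons-inj : Injective _≡_ _≡_ (a ∷ q)
    cons-inj {zero}   {zero}   _  = refl
    cons-inj {zero}   {fsuc j} eq = ⊥-elim (a∉q j (sym eq))
    cons-inj {fsuc i} {zero}   eq = ⊥-elim (a∉q i eq)
    cons-inj {fsuc i} {fsuc j} eq = cong fsuc (q-inj eq)

    cons-arcs : ∀ i → (a ∷ q) (inject₁ i) ⇒ (a ∷ q) (fsuc i)
    cons-arcs zero     = a⇒q₀
    cons-arcs (fsuc i) = q-arcs i

  -- Loop erasure: if the walk revisits its first vertex, keep the suffix from that visit.
  walk⇒path : ∀ {j a c} → Walk j a c → PathWithin j a c
  walk⇒path {a = a} ε = 0 , (λ _ → a) , ((λ { {zero} {zero} _ → refl }) , λ ()) , refl , refl , z≤n
  walk⇒path {a = a} (a⇒b ◅ w) with walk⇒path w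
  ... | l , q , q-path , refl , q-end , l≤j with any? (λ i → q i ≟ᶠ a)
  ...   | yes (i , refl) =
          let l′ , q′ , q′-path , start , end , l′≤l = path-suffix l q-path i
          in l′ , q′ , q′-path , start , trans end q-end , m≤n⇒m≤1+n (≤-trans l′≤l l≤j)
  ...   | no a∉q = suc l , a ∷ q , path-cons a⇒b (λ i qᵢ≡a → a∉q (i , qᵢ≡a)) q-path
                 , refl , q-end , s≤s l≤j

module ShortestPath {n : ℕ} (T : Tournament n) (k : ℕ) (p : Fin (suc k) → Fin n)
                    (shortest : IsShortestDirPath T k p) where
  open Tournament T
  open Tournaments T

  path : ℕ → Fin n
  path x = p (clamp k x)

  p≡path : ∀ i → p i ≡ path (toℕ i)
  p≡path i = cong p (sym (clamp-toℕ k i))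

  path-arc : ∀ {x} → x < k → path x ⇒ path (suc x)
  path-arc x<k with clamp-suc x<k
  ... | i , eq , eq′ = subst₂ _⇒_ (cong p (sym eq)) (cong p (sym eq′)) (proj₂ (proj₁ shortest) i)

  walk-along : ∀ {x y} d → x + d ≡ y → y ≤ k → Walk d (path x) (path y)
  walk-along {x} zero    x+0≡y _   = subst (Walk 0 (path x) ∘ path) (trans (sym (+-identityʳ x)) x+0≡y) ε
  walk-along {x} (suc d) x+d≡y y≤k = path-arc x<k ◅ walk-along d (trans (sym (+-suc x d)) x+d≡y) y≤k
    where
    x<k : x < k
    x<k = <-≤-trans (m<m+n x z<s) (subst (_≤ k) (sym x+d≡y) y≤k)

  shortest-walk : ∀ {j} → Walk j (p zero) (p (fromℕ k)) → k ≤ j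
  shortest-walk w with walk⇒path w
  ... | l , q , q-path , start , end , l≤j = ≤-trans (proj₂ shortest l q q-path start end) l≤j

  path-distance : ∀ {x y j} → x ≤ k → y ≤ k → Walk j (path x) (path y) → y ≤ x + j
  path-distance {x} {y} {j} x≤k y≤k w = +-cancelʳ-≤ (k ∸ y) y (x + j) (begin
    y + (k ∸ y)      ≡⟨ m+[n∸m]≡n y≤k ⟩
    k                ≤⟨ shortest-walk detour ⟩
    x + j + (k ∸ y)  ∎)
    where
    open ≤-Reasoning
    detour : Walk (x + j + (k ∸ y)) (p zero) (p (fromℕ k))
    detour = subst (Walk _ (p zero)) (cong p (clamp-self k))
               ((walk-along x refl x≤k ◅◅ w) ◅◅ walk-along (k ∸ y) (m+[n∸m]≡n y≤k) ≤-refl)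

  S : VSet n
  S w = (N⁻ T (p zero) w × N⁺ T (p (fromℕ k)) w) ⊎ PathVerts T k p w

  onPath? : Decidable (PathVerts T k p)
  onPath? w = any? (λ i → p i ≟ᶠ w)

  lastOut : Fin n → ℕ
  lastOut w = lastBelow (λ x → w ⇒? path x) k

  module _ {w} (w∈S : S w) (w∉P : ¬ PathVerts T k p w) where

    w⇒p₀ : w ⇒ p zero
    w⇒p₀ = [ proj₁ , ⊥-elim ∘ w∉P ]′ w∈S

    pₖ⇒w : p (fromℕ k) ⇒ w
    pₖ⇒w = [ proj₂ , ⊥-elim ∘ w∉P ]′ w∈S

    lastOut-arc : w ⇒ path (lastOut w)
    lastOut-arc = lastBelow-holds (λ x → w ⇒? path x) w⇒p₀ k

    lastOut-after : ∀ {y} → lastOut w < y → y ≤ k → path y ⇒ w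
    lastOut-after {y} last<y y≤k with total (path y) w (λ pathy≡w → w∉P (clamp k y , pathy≡w))
    ... | inj₁ pathy⇒w = pathy⇒w
    ... | inj₂ w⇒pathy = ⊥-elim (lastBelow-maximal (λ x → w ⇒? path x) k last<y y≤k w⇒pathy)

    lastOut<k : lastOut w < k
    lastOut<k = ≤∧≢⇒< (lastBelow-≤ (λ x → w ⇒? path x) k) λ last≡k →
      asym _ _ pₖ⇒w (subst (w ⇒_) (cong p (trans (cong (clamp k) last≡k) (clamp-self k))) lastOut-arc)

    lastOut-between : lastOut w < k × Narc T (path (lastOut w)) (path (suc (lastOut w))) w
    lastOut-between = lastOut<k , lastOut-after (n<1+n _) lastOut<k , lastOut-arc

  level : Fin n → ℕ
  level w with onPath? w
  ... | yes (i , _) = toℕ i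
  ... | no _        = lastOut w

  level-arc : ∀ {u v} → S u → S v → u ⇒ v → level v ≤ level u + 4
  level-arc {u} {v} u∈S v∈S u⇒v with onPath? u | onPath? v
  ... | yes (i , refl) | yes (j , refl) =
        ≤-trans (path-distance (toℕ≤pred[n] i) (toℕ≤pred[n] j)
                  (subst₂ _⇒_ (p≡path i) (p≡path j) u⇒v ◅ ε))
                (+-monoʳ-≤ (toℕ i) (s≤s z≤n))
  ... | yes (i , refl) | no v∉P =
        ≤-trans (path-distance (toℕ≤pred[n] i) (<⇒≤ (lastOut<k v∈S v∉P))
                  (subst (_⇒ v) (p≡path i) u⇒v ◅ lastOut-arc v∈S v∉P ◅ ε))
                (+-monoʳ-≤ (toℕ i) (s≤s (s≤s z≤n)))
  ... | no u∉P | yes (j , refl) =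
        ≤-trans (≮⇒≥ λ last<j → asym _ _ (lastOut-after u∈S u∉P last<j (toℕ≤pred[n] j))
                                         (subst (u ⇒_) (p≡path j) u⇒v))
                (m≤m+n (lastOut u) 4)
  ... | no u∉P | no v∉P =
        subst (lastOut v ≤_) (sym (+-suc (lastOut u) 3))
          (path-distance (lastOut<k u∈S u∉P) (<⇒≤ (lastOut<k v∈S v∉P))
            (lastOut-after u∈S u∉P (n<1+n _) (lastOut<k u∈S u∉P) ◅ u⇒v ◅ lastOut-arc v∈S v∉P ◅ ε))

  layer-member : ∀ {ℓ w} → S w → level w ≡ ℓ →
    w ≡ path ℓ ⊎ (ℓ < k × Narc T (path ℓ) (path (suc ℓ)) w)
  layer-member {ℓ} {w} w∈S level≡ℓ with onPath? w
  ... | yes (i , refl) = inj₁ (trans (p≡path i) (cong path level≡ℓ))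
  ... | no w∉P = inj₂ (subst (λ x → x < k × Narc T (path x) (path (suc x)) w)
                             level≡ℓ (lastOut-between w∈S w∉P))

  layer-sink : ∀ {ℓ w} → S w → level w ≡ ℓ → ¬ (path ℓ ⇒ w)
  layer-sink w∈S level≡ℓ pathℓ⇒w with layer-member w∈S level≡ℓ
  ... | inj₁ refl              = irrefl _ pathℓ⇒w
  ... | inj₂ (_ , _ , w⇒pathℓ) = asym _ _ pathℓ⇒w w⇒pathℓ

  Layer : ℕ → VSet n
  Layer ℓ w = S w × level w ≡ ℓ

  layer-dichromatic : ∀ {t} → Fin t → ArcBounded T t → ∀ ℓ → DichromaticLE T (Layer ℓ) t
  layer-dichromatic c₀ bounded ℓ with ℓ <? k
  ... | yes ℓ<k = dichromatic-addSink {Y = Layer ℓ} (bounded _ _ (path-arc ℓ<k))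
                    (λ (w∈S , level≡ℓ) → [ inj₂ , inj₁ ∘ proj₂ ]′ (layer-member w∈S level≡ℓ))
                    (λ (w∈S , level≡ℓ) → layer-sink w∈S level≡ℓ)
  ... | no ℓ≮k  = dichromatic-addSink {Y = Layer ℓ} (dichromatic-∅ c₀)
                    (λ (w∈S , level≡ℓ) → [ inj₂ , ⊥-elim ∘ ℓ≮k ∘ proj₁ ]′ (layer-member w∈S level≡ℓ))
                    (λ (w∈S , level≡ℓ) → layer-sink w∈S level≡ℓ)

lemma2p4 : ∀ {n : ℕ} (T : Tournament n) (t : ℕ) → 1 ≤ t → ArcBounded T t →
    ∀ (k : ℕ) (p : Fin (suc k) → Fin n) → IsShortestDirPath T k p →
    DichromaticLE T (λ w → (N⁻ T (p zero) w × N⁺ T (p (fromℕ k)) w) ⊎ PathVerts T k p w) (5 * t)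
lemma2p4 T t 1≤t bounded k p shortest =
  dichromatic-layers {X = S} 5 level
    (λ u∈S v∈S u⇒v → ≤-<-trans (level-arc u∈S v∈S u⇒v) (+-monoʳ-< _ ≤-refl))
    (layer-dichromatic (fromℕ< 1≤t) bounded)
  where
  open Tournaments T
  open ShortestPath T k p shortest
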